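{- Let $G$ be a finite simple connected graph with weights $a,b:V(G)\to\mathbb{R}^+$, let $c\in V(G)$ and $C=[c]_R=\{c_1,\ldots,c_k\}$. Let $G'=G\setminus(C\setminus\{c\})$ and define $a',b':V(G')\to\mathbb{R}^+$ by $a'(c)=\sum_{x\in C}a(x)$, $b'(c)=\sum_{x\in C}b(x)$, and $a'(x)=a(x)$, $b'(x)=b(x)$ for $x\notin C$. Then $$W(G,a,b)=W(G',a',b')+\sum_{\{c_i,c_j\}\subseteq C}2\left(a(c_i)b(c_j)+a(c_j)b(c_i)\right).$$
   Context: Vertices $x,y$ are in relation $R$ if $N(x)=N(y)$, where $N(x)$ is the open neighbourhood; $[x]_R$ denotes the $R$-class of $x$. $G\setminus S$ for a vertex set $S$ denotes deletion of the vertices in $S$. $W(H,a,b)=\sum_{\{u,v\}\subseteq V(H)}(a(u)b(v)+a(v)b(u))d_H(u,v)$, sum over unordered pairs of distinct vertices; the final sum in the claim is over unordered pairs of distinct elements of $C$. -}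

module Defs where

open import Level using (Level)
open import Data.Bool using (Bool; true; false; _∧_; _∨_; not; if_then_else_)
open import Data.Nat using (ℕ; zero; suc; _<ᵇ_)
open import Data.Fin using (Fin; toℕ)
open import Data.Fin.Properties using (_≟_)
open import Relation.Nullary.Decidable using (⌊_⌋)
open import Relation.Binary.PropositionalEquality using (_≡_)
open import Algebra.Bundles using (CommutativeSemiring)

record Graph : Set where
  field
    n      : ℕ
    adj    : Fin n → Fin n → Bool
    sym    : ∀ u v → adj u v ≡ adj v u
    irrefl : ∀ u → adj u u ≡ false
open Graph public

anyF : ∀ {m} → (Fin m → Bool) → Bool
anyF {zero}  p = false
anyF {suc m} p = p Fin.zero ∨ anyF (λ i → p (Fin.suc i))
  where import Data.Fin as Fin

allF : ∀ {m} → (Fin m → Bool) → Bool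
allF p = not (anyF (λ i → not (p i)))

VSet : Graph → Set
VSet G = Fin (n G) → Bool

allV : (G : Graph) → VSet G
allV G _ = true

-- reachIn G S k u v : there is a walk of length exactly k from u to v
-- all of whose vertices lie in S (i.e. a walk in the induced subgraph G[S]).
reachIn : (G : Graph) → VSet G → ℕ → Fin (n G) → Fin (n G) → Bool
reachIn G S zero    u v = S u ∧ ⌊ u ≟ v ⌋
reachIn G S (suc k) u v = S u ∧ anyF (λ w → adj G u w ∧ reachIn G S k w v)

Connected : Graph → Set
Connected G = ∀ u v → Σ ℕ (λ k → reachIn G (allV G) k u v ≡ true)
  where open import Data.Product using (Σ)

-- distance in G[S]: least k with a walk of length k (search up to n;
-- in a connected induced subgraph the distance is always < n).
distSearch : (G : Graph) → VSet G → Fin (n G) → Fin (n G) → ℕ → ℕ → ℕ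
distSearch G S u v k zero = k
distSearch G S u v k (suc f) =
  if reachIn G S k u v then k else distSearch G S u v (suc k) f

distIn : (G : Graph) → VSet G → Fin (n G) → Fin (n G) → ℕ
distIn G S u v = distSearch G S u v 0 (n G)

R : (G : Graph) → Fin (n G) → Fin (n G) → Set
R G x y = ∀ w → adj G x w ≡ adj G y w

inClass : (G : Graph) → Fin (n G) → Fin (n G) → Bool
inClass G c x = allF (λ w → ⌊ Data.Bool._≟_ (adj G c w) (adj G x w) ⌋)
  where import Data.Bool

G'set : (G : Graph) → Fin (n G) → VSet G
G'set G c x = not (inClass G c x ∧ not ⌊ x ≟ c ⌋)

module Weighted {c ℓ : Level} (S : CommutativeSemiring c ℓ) where
  open CommutativeSemiring S

  _·_ : ℕ → Carrier → Carrier
  zero  · r = 0#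
  suc k · r = r + (k · r)

  sumF : ∀ {m} → (Fin m → Carrier) → Carrier
  sumF {zero}  f = 0#
  sumF {suc m} f = f Fin.zero + sumF (λ i → f (Fin.suc i))
    where import Data.Fin as Fin

  -- sum over unordered pairs {u,v} of distinct vertices of the vertex set T
  -- (each pair counted once, as u < v)
  sumPairs : (G : Graph) → VSet G → (Fin (n G) → Fin (n G) → Carrier) → Carrier
  sumPairs G T f = sumF (λ u → sumF (λ v →
    if (toℕ u <ᵇ toℕ v) ∧ T u ∧ T v then f u v else 0#))

  W : (G : Graph) → VSet G → (Fin (n G) → Carrier) → (Fin (n G) → Carrier) → Carrier
  W G T a b = sumPairs G T (λ u v → distIn G T u v · ((a u * b v) + (a v * b u)))

  sumClass : (G : Graph) → Fin (n G) → (Fin (n G) → Carrier) → Carrier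
  sumClass G c a = sumF (λ x → if inClass G c x then a x else 0#)

  -- merged weight a' on G': a'(c) = Σ_{x∈C} a(x), a'(x) = a(x) for x ∉ C
  -- (values on deleted vertices are irrelevant; they are left as a(x))
  merged : (G : Graph) → Fin (n G) → (Fin (n G) → Carrier) → Fin (n G) → Carrier
  merged G c a x = if ⌊ x ≟ c ⌋ then sumClass G c a else a x

-- Collapsing the twin class C = [c]_R onto c, φ x = if x ∈ C then c else x, preserves
-- adjacency in both directions, so walks of positive length in G and in
-- G′ = G ∖ (C ∖ {c}) correspond under φ. Hence d_G(u,v) = d_G′(φ u, φ v) unless u, v are
-- distinct twins, which are non-adjacent with a common neighbour and so at distance 2.
-- Splitting W(G,a,b) by how many endpoints of a pair lie in C: pairs outside C contribute
-- equally to both sides, pairs inside C give the correction term, and the pairs {u,v} with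
-- only u ∈ C, all at distance d_G′(c,v), add up to the pair {c,v} of G′ with merged weights.
module Submission where

open import Defs hiding (sym)
open import Level using (Level)
open import Data.Bool using (Bool; true; false; _∧_; not; if_then_else_)
open import Data.Bool.Properties using (∧-zeroʳ; ¬-not; ⇔→≡) renaming (_≟_ to _≟ᵇ_)
open import Data.Nat using (ℕ; zero; suc; _≤_; z≤n; s≤s; _<ᵇ_)
open import Data.Nat.Properties using (<-cmp; _<?_; <-irrefl)
open import Data.Fin using (Fin; zero; suc; toℕ; punchIn)
open import Data.Fin.Properties using (_≟_; punchInᵢ≢i; toℕ-injective)
open import Data.Vec.Functional using (map)
open import Data.Empty using (⊥-elim)
open import Function using (_∘_)
open import Function.Bundles using (mk⇔)
open import Relation.Nullary using (Dec; yes; no; ¬_)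
open import Relation.Nullary.Decidable using (⌊_⌋; isYes≗does; dec-true; dec-false)
open import Relation.Binary using (tri<; tri≈; tri>)
open import Relation.Binary.PropositionalEquality as ≡ using (_≡_; _≢_)
open import Algebra.Bundles using (CommutativeSemiring)

-- A submodule, so that the pair type _×_ stays out of scope of the sums below, where
-- _×_ is the natural-number multiple.
module Walks where
  open import Data.Product using (∃; _×_; _,_; proj₁; proj₂)
  open ≡

  ∧-true : ∀ {x y} → x ≡ true → y ≡ true → x ∧ y ≡ true
  ∧-true refl refl = refl

  ∧-true⁻ : ∀ {x y} → x ∧ y ≡ true → x ≡ true × y ≡ true
  ∧-true⁻ {true} {true} _ = refl , refl

  module _ {a} {P : Set a} (P? : Dec P) where

    ⌊⌋-true : P → ⌊ P? ⌋ ≡ true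
    ⌊⌋-true p = trans (isYes≗does P?) (dec-true P? p)

    ⌊⌋-false : ¬ P → ⌊ P? ⌋ ≡ false
    ⌊⌋-false ¬p = trans (isYes≗does P?) (dec-false P? ¬p)

  ⌊⌋-true⁻ : ∀ {a} {P : Set a} (P? : Dec P) → ⌊ P? ⌋ ≡ true → P
  ⌊⌋-true⁻ (yes p) _ = p

  anyF-intro : ∀ {m} (p : Fin m → Bool) w → p w ≡ true → anyF p ≡ true
  anyF-intro p zero    pw rewrite pw = refl
  anyF-intro p (suc w) pw with p zero
  ... | true  = refl
  ... | false = anyF-intro (p ∘ suc) w pw

  anyF-elim : ∀ {m} (p : Fin m → Bool) → anyF p ≡ true → ∃ λ w → p w ≡ true
  anyF-elim {suc m} p e with p zero in p₀
  ... | true  = zero , p₀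
  ... | false with anyF-elim (p ∘ suc) e
  ...   | w , pw = suc w , pw

  allF-elim : ∀ {m} (p : Fin m → Bool) → allF p ≡ true → ∀ i → p i ≡ true
  allF-elim p e i with p i in pᵢ
  ... | true  = refl
  ... | false rewrite anyF-intro (λ j → not (p j)) i (cong not pᵢ) = e

  allF-intro : ∀ {m} (p : Fin m → Bool) → (∀ i → p i ≡ true) → allF p ≡ true
  allF-intro {zero}  p h = refl
  allF-intro {suc m} p h rewrite h zero = allF-intro (p ∘ suc) (h ∘ suc)

  distinct⇒2≤ : ∀ {m} {u v : Fin m} → u ≢ v → 2 ≤ m
  distinct⇒2≤ {suc zero}    {zero} {zero} u≢v = ⊥-elim (u≢v refl)
  distinct⇒2≤ {suc (suc m)} _ = s≤s (s≤s z≤n)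

  module _ (G : Graph) (T : VSet G) where

    reachIn-start : ∀ k {u v} → reachIn G T k u v ≡ true → T u ≡ true
    reachIn-start zero    r = proj₁ (∧-true⁻ r)
    reachIn-start (suc k) r = proj₁ (∧-true⁻ r)

    reachIn-zero : ∀ {u} → T u ≡ true → reachIn G T 0 u u ≡ true
    reachIn-zero {u} Tu = ∧-true Tu (⌊⌋-true (u ≟ u) refl)

    reachIn-zero⁻ : ∀ {u v} → reachIn G T 0 u v ≡ true → u ≡ v
    reachIn-zero⁻ {u} {v} r = ⌊⌋-true⁻ (u ≟ v) (proj₂ (∧-true⁻ r))

    reachIn-zero-≢ : ∀ {u v} → u ≢ v → reachIn G T 0 u v ≡ false
    reachIn-zero-≢ {u} {v} u≢v = trans (cong (T u ∧_) (⌊⌋-false (u ≟ v) u≢v)) (∧-zeroʳ (T u))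

    reachIn-suc : ∀ k {u w v} → T u ≡ true → adj G u w ≡ true → reachIn G T k w v ≡ true →
                  reachIn G T (suc k) u v ≡ true
    reachIn-suc k {w = w} Tu uw r = ∧-true Tu (anyF-intro _ w (∧-true uw r))

    reachIn-suc⁻ : ∀ k {u v} → reachIn G T (suc k) u v ≡ true →
                   ∃ λ w → adj G u w ≡ true × reachIn G T k w v ≡ true
    reachIn-suc⁻ k r with anyF-elim _ (proj₂ (∧-true⁻ r))
    ... | w , q = w , ∧-true⁻ q

    reachIn-snoc : ∀ k {u w v} → reachIn G T k u w ≡ true → adj G w v ≡ true → T v ≡ true →
                   reachIn G T (suc k) u v ≡ true
    reachIn-snoc zero r wv Tv with reachIn-zero⁻ r
    ... | refl = reachIn-suc 0 (reachIn-start 0 r) wv (reachIn-zero Tv)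
    reachIn-snoc (suc k) r wv Tv with reachIn-suc⁻ k r
    ... | x , ux , rx = reachIn-suc (suc k) (reachIn-start (suc k) r) ux (reachIn-snoc k rx wv Tv)

    reachIn-reverse : ∀ k {u v} → reachIn G T k u v ≡ true → reachIn G T k v u ≡ true
    reachIn-reverse zero r with reachIn-zero⁻ r
    ... | refl = r
    reachIn-reverse (suc k) {u} r with reachIn-suc⁻ k r
    ... | w , uw , rw = reachIn-snoc k (reachIn-reverse k rw) (trans (Graph.sym G w u) uw) (reachIn-start (suc k) r)

    reachIn-sym : ∀ k u v → reachIn G T k u v ≡ reachIn G T k v u
    reachIn-sym k u v = ⇔→≡ (mk⇔ (reachIn-reverse k) (reachIn-reverse k))

  module _ {G : Graph} {T T′ : VSet G} {u v u′ v′ : Fin (n G)}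
           (same : ∀ k → reachIn G T k u v ≡ reachIn G T′ k u′ v′) where

    distSearch-cong : ∀ k f → distSearch G T u v k f ≡ distSearch G T′ u′ v′ k f
    distSearch-cong k zero    = refl
    distSearch-cong k (suc f) rewrite same k = cong (if reachIn G T′ k u′ v′ then k else_) (distSearch-cong (suc k) f)

    distIn-cong : distIn G T u v ≡ distIn G T′ u′ v′
    distIn-cong = distSearch-cong 0 (n G)

  module _ (G : Graph) (T : VSet G) where

    distIn-sym : ∀ u v → distIn G T u v ≡ distIn G T v u
    distIn-sym u v = distIn-cong (λ k → reachIn-sym G T k u v)

    distIn≡2 : ∀ {u v} → u ≢ v → reachIn G T 1 u v ≡ false → reachIn G T 2 u v ≡ true → distIn G T u v ≡ 2
    distIn≡2 {u} {v} u≢v r₁ r₂ = search (distinct⇒2≤ u≢v)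
      where
      -- Out of fuel, distSearch returns the fuel itself: for n G = 2 no walk of length 2 is checked.
      search : ∀ {f} → 2 ≤ f → distSearch G T u v 0 f ≡ 2
      search {suc zero} (s≤s ())
      search {suc (suc zero)}    _ rewrite reachIn-zero-≢ G T u≢v | r₁ = refl
      search {suc (suc (suc f))} _ rewrite reachIn-zero-≢ G T u≢v | r₁ | r₂ = refl

  module TwinCollapse (G : Graph) (c : Fin (n G)) where

    C : VSet G
    C = inClass G c

    S : VSet G
    S = G'set G c

    φ : Fin (n G) → Fin (n G)
    φ x = if C x then c else x

    inClass⇒R : ∀ {x} → C x ≡ true → R G c x
    inClass⇒R {x} x∈C w = ⌊⌋-true⁻ (adj G c w ≟ᵇ adj G x w) (allF-elim _ x∈C w)

    c∈C : C c ≡ true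
    c∈C = allF-intro _ (λ w → ⌊⌋-true (adj G c w ≟ᵇ adj G c w) refl)

    ∈C-∉C⇒≢ : ∀ {x y} → C x ≡ true → C y ≡ false → x ≢ y
    ∈C-∉C⇒≢ x∈C y∉C refl with trans (sym x∈C) y∉C
    ... | ()

    ∉C⇒≢c : ∀ {x} → C x ≡ false → x ≢ c
    ∉C⇒≢c x∉C = ∈C-∉C⇒≢ c∈C x∉C ∘ sym

    twins-adj : ∀ {x y} → C x ≡ true → C y ≡ true → ∀ w → adj G x w ≡ adj G y w
    twins-adj x∈C y∈C w = trans (sym (inClass⇒R x∈C w)) (inClass⇒R y∈C w)

    φ-∈C : ∀ {x} → C x ≡ true → φ x ≡ c
    φ-∈C x∈C rewrite x∈C = refl

    φ-∉C : ∀ {x} → C x ≡ false → φ x ≡ x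
    φ-∉C x∉C rewrite x∉C = refl

    φ∈S : ∀ x → S (φ x) ≡ true
    φ∈S x with C x in x∈C
    ... | false rewrite x∈C = refl
    ... | true  rewrite c∈C | ⌊⌋-true (c ≟ c) refl = refl

    adj-φˡ : ∀ x y → adj G (φ x) y ≡ adj G x y
    adj-φˡ x y with C x in x∈C
    ... | true  = inClass⇒R x∈C y
    ... | false = refl

    adj-φʳ : ∀ x y → adj G x (φ y) ≡ adj G x y
    adj-φʳ x y = trans (Graph.sym G x (φ y)) (trans (adj-φˡ y x) (Graph.sym G y x))

    adj-φ : ∀ x y → adj G (φ x) (φ y) ≡ adj G x y
    adj-φ x y = trans (adj-φˡ x (φ y)) (adj-φʳ x y)

    twins-nonadjacent : ∀ {x y} → C x ≡ true → C y ≡ true → adj G x y ≡ false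
    twins-nonadjacent {x} {y} x∈C y∈C = begin
      adj G x y ≡⟨ adj-φ x y ⟨
      adj G (φ x) (φ y) ≡⟨ cong₂ (adj G) (φ-∈C x∈C) (φ-∈C y∈C) ⟩
      adj G c c ≡⟨ irrefl G c ⟩
      false ∎
      where open ≡-Reasoning

    reach-collapse : ∀ k {u v} → reachIn G (allV G) k u v ≡ true → reachIn G S k (φ u) (φ v) ≡ true
    reach-collapse zero {u} {v} r with reachIn-zero⁻ G (allV G) r
    ... | refl = reachIn-zero G S (φ∈S _)
    reach-collapse (suc k) {u} r with reachIn-suc⁻ G (allV G) k r
    ... | w , uw , rw = reachIn-suc G S k (φ∈S u) (trans (adj-φ u w) uw) (reach-collapse k rw)

    reach-expand : ∀ k {x v} → reachIn G S (suc k) x (φ v) ≡ true → reachIn G (allV G) (suc k) x v ≡ true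
    reach-expand k r with reachIn-suc⁻ G S k r
    reach-expand zero    {x} {v} r | w , xw , rw with reachIn-zero⁻ G S rw
    ... | refl = reachIn-suc G (allV G) 0 refl (trans (sym (adj-φʳ x v)) xw) (reachIn-zero G (allV G) refl)
    reach-expand (suc k) {x} {v} r | w , xw , rw =
      reachIn-suc G (allV G) (suc k) refl xw (reach-expand k {w} {v} rw)

    reach-from-φ : ∀ k {u v} → reachIn G (allV G) (suc k) (φ u) v ≡ true → reachIn G (allV G) (suc k) u v ≡ true
    reach-from-φ k {u} r with reachIn-suc⁻ G (allV G) k r
    ... | w , uw , rw = reachIn-suc G (allV G) k refl (trans (sym (adj-φˡ u w)) uw) rw

    reachIn-collapse : ∀ {u v} → ⌊ u ≟ v ⌋ ≡ ⌊ φ u ≟ φ v ⌋ →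
                       ∀ k → reachIn G (allV G) k u v ≡ reachIn G S k (φ u) (φ v)
    reachIn-collapse {u} u≟v zero    rewrite φ∈S u = u≟v
    reachIn-collapse     u≟v (suc k) =
      ⇔→≡ (mk⇔ (reach-collapse (suc k)) (reach-from-φ k ∘ reach-expand k))

    distIn-collapse : ∀ {u v u′ v′} → φ u ≡ u′ → φ v ≡ v′ → ⌊ u ≟ v ⌋ ≡ ⌊ u′ ≟ v′ ⌋ →
                      distIn G (allV G) u v ≡ distIn G S u′ v′
    distIn-collapse refl refl u≟v = distIn-cong (reachIn-collapse u≟v)

    distIn-∉C : ∀ {u v} → C u ≡ false → C v ≡ false → distIn G (allV G) u v ≡ distIn G S u v
    distIn-∉C u∉C v∉C = distIn-collapse (φ-∉C u∉C) (φ-∉C v∉C) refl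

    distIn-∈C-∉C : ∀ {u v} → C u ≡ true → C v ≡ false → distIn G (allV G) u v ≡ distIn G S c v
    distIn-∈C-∉C {u} {v} u∈C v∉C = distIn-collapse (φ-∈C u∈C) (φ-∉C v∉C)
      (trans (⌊⌋-false (u ≟ v) (∈C-∉C⇒≢ u∈C v∉C)) (sym (⌊⌋-false (c ≟ v) (∈C-∉C⇒≢ c∈C v∉C))))

    distIn-twins : Connected G → ∀ {u v} → C u ≡ true → C v ≡ true → u ≢ v → distIn G (allV G) u v ≡ 2
    distIn-twins conn {u} {v} u∈C v∈C u≢v with conn u v
    ... | zero  , r = ⊥-elim (u≢v (reachIn-zero⁻ G (allV G) r))
    ... | suc k , r with reachIn-suc⁻ G (allV G) k r
    ...   | w , uw , _ = distIn≡2 G (allV G) u≢v (¬-not not-adjacent) (reachIn-suc G (allV G) 1 refl uw walk-wv)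
      where
      walk-wv : reachIn G (allV G) 1 w v ≡ true
      walk-wv = reachIn-suc G (allV G) 0 refl (trans (Graph.sym G w v) (trans (twins-adj v∈C u∈C w) uw))
                  (reachIn-zero G (allV G) refl)
      not-adjacent : reachIn G (allV G) 1 u v ≢ true
      not-adjacent r₁ with reachIn-suc⁻ G (allV G) 0 r₁
      ... | x , ux , rx with reachIn-zero⁻ G (allV G) rx
      ...   | refl with trans (sym ux) (twins-nonadjacent u∈C v∈C)
      ...     | ()

open Walks

lt : ∀ {m} → Fin m → Fin m → Bool
lt u v = toℕ u <ᵇ toℕ v

lt⇒≢ : ∀ {m} (u v : Fin m) → lt u v ≡ true → u ≢ v
lt⇒≢ u _ u<v ≡.refl with ≡.trans (≡.sym u<v) (dec-false (toℕ u <? toℕ u) (<-irrefl ≡.refl))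
... | ()

lt-flip : ∀ {m} {u v : Fin m} → u ≢ v → lt v u ≡ not (lt u v)
lt-flip {u = u} {v} u≢v with <-cmp (toℕ u) (toℕ v)
... | tri< u<v _ v≮u = ≡.trans (dec-false (toℕ v <? toℕ u) v≮u) (≡.cong not (≡.sym (dec-true (toℕ u <? toℕ v) u<v)))
... | tri≈ _ u≡v _   = ⊥-elim (u≢v (toℕ-injective u≡v))
... | tri> u≮v _ v<u = ≡.trans (dec-true (toℕ v <? toℕ u) v<u) (≡.cong not (≡.sym (dec-false (toℕ u <? toℕ v) u≮v)))

module Sums {ℓc ℓ} (K : CommutativeSemiring ℓc ℓ) where
  open CommutativeSemiring K hiding (zero)
  open Weighted K
  open import Algebra.Properties.Semiring.Sum semiring
  open import Algebra.Properties.Semiring.Mult semiring using (_×_; ×-cong; ×-congʳ; ×-congˡ; ×-assoc-*)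
  open import Algebra.Solver.CommutativeMonoid +-commutativeMonoid using (solve; _⊕_; _⊜_; id)
  open import Relation.Binary.Reasoning.Setoid setoid

  sumF≡sum : ∀ {m} (f : Fin m → Carrier) → sumF f ≡ sum f
  sumF≡sum {zero}  f = ≡.refl
  sumF≡sum {suc m} f = ≡.cong (f zero +_) (sumF≡sum (f ∘ suc))

  ·≡× : ∀ k x → k · x ≡ k × x
  ·≡× zero    x = ≡.refl
  ·≡× (suc k) x = ≡.cong (x +_) (·≡× k x)

  ×-as-* : ∀ k x → k × x ≈ (k × 1#) * x
  ×-as-* k x = sym (trans (×-assoc-* k 1# x) (×-congʳ k (*-identityˡ x)))

  ×-distrib-sum : ∀ {m} k (f : Fin m → Carrier) → k × sum f ≈ sum (λ i → k × f i)
  ×-distrib-sum k f = begin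
    k × sum f                         ≈⟨ ×-as-* k (sum f) ⟩
    (k × 1#) * sum f                  ≈⟨ *-distribˡ-sum (k × 1#) f ⟩
    sum (map ((k × 1#) *_) f)         ≈⟨ sum-cong-≋ (sym ∘ ×-as-* k ∘ f) ⟩
    sum (λ i → k × f i)               ∎

  sum-pick : ∀ {m} (f : Fin m → Carrier) j → (∀ i → i ≢ j → f i ≈ 0#) → sum f ≈ f j
  sum-pick {suc m} f j off = begin
    sum f                                      ≈⟨ sum-remove {i = j} f ⟩
    f j + sum (λ k → f (punchIn j k))      ≈⟨ +-congˡ (sum-cong-≋ {m} (λ k → off _ (punchInᵢ≢i j k))) ⟩
    f j + sum {m} (λ _ → 0#)                   ≈⟨ +-congˡ (sum-replicate-zero m) ⟩
    f j + 0#                                   ≈⟨ +-identityʳ (f j) ⟩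
    f j                                        ∎

  [_]_ : Bool → Carrier → Carrier
  [ b ] x = if b then x else 0#

  []-true : ∀ {b x} → b ≡ true → [ b ] x ≈ x
  []-true ≡.refl = refl

  []-false : ∀ {b x} → b ≡ false → [ b ] x ≈ 0#
  []-false ≡.refl = refl

  []-cong : ∀ b {x y} → x ≈ y → [ b ] x ≈ [ b ] y
  []-cong true  x≈y = x≈y
  []-cong false _   = refl

  []-+ : ∀ b x y → [ b ] (x + y) ≈ [ b ] x + [ b ] y
  []-+ true  x y = refl
  []-+ false x y = sym (+-identityˡ 0#)

  []-*ˡ : ∀ b x y → [ b ] (x * y) ≈ x * [ b ] y
  []-*ˡ true  x y = refl
  []-*ˡ false x y = sym (zeroʳ x)

  []-*ʳ : ∀ b x y → [ b ] (x * y) ≈ [ b ] x * y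
  []-*ʳ true  x y = refl
  []-*ʳ false x y = sym (zeroˡ y)

  ×-zeroʳ : ∀ k → k × 0# ≈ 0#
  ×-zeroʳ zero    = refl
  ×-zeroʳ (suc k) = trans (+-identityˡ (k × 0#)) (×-zeroʳ k)

  []-× : ∀ b k x → [ b ] (k × x) ≈ k × [ b ] x
  []-× true  k x = refl
  []-× false k x = sym (×-zeroʳ k)

  []-sum : ∀ {m} b (f : Fin m → Carrier) → sum (λ i → [ b ] f i) ≈ [ b ] sum f
  []-sum {m} true  f = refl
  []-sum {m} false f = sum-replicate-zero m

  []-0 : ∀ b {x} → x ≈ 0# → [ b ] x ≈ 0#
  []-0 true  x≈0 = x≈0
  []-0 false _   = refl

  []-split : ∀ b x → [ b ] x + [ not b ] x ≈ x
  []-split true  x = +-identityʳ x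
  []-split false x = +-identityˡ x

  ∑∑ : ∀ {m} → (Fin m → Fin m → Carrier) → Carrier
  ∑∑ f = sum (λ u → sum (f u))

  ∑∑-cong : ∀ {m} {f g : Fin m → Fin m → Carrier} → (∀ u v → f u v ≈ g u v) → ∑∑ f ≈ ∑∑ g
  ∑∑-cong f≈g = sum-cong-≋ (λ u → sum-cong-≋ (f≈g u))

  ∑∑-distrib-+ : ∀ {m} (f g : Fin m → Fin m → Carrier) → ∑∑ (λ u v → f u v + g u v) ≈ ∑∑ f + ∑∑ g
  ∑∑-distrib-+ f g = trans (sum-cong-≋ (λ u → ∑-distrib-+ (f u) (g u))) (∑-distrib-+ (λ u → sum (f u)) (λ u → sum (g u)))

  ∑∑-unordered : ∀ {m} (N : Fin m → Fin m → Carrier) → (∀ u → N u u ≈ 0#) →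
                 ∑∑ (λ u v → [ lt u v ] N u v + [ lt u v ] N v u) ≈ ∑∑ N
  ∑∑-unordered N diag = begin
    ∑∑ (λ u v → [ lt u v ] N u v + [ lt u v ] N v u)
      ≈⟨ ∑∑-distrib-+ (λ u v → [ lt u v ] N u v) (λ u v → [ lt u v ] N v u) ⟩
    ∑∑ (λ u v → [ lt u v ] N u v) + ∑∑ (λ u v → [ lt u v ] N v u)
      ≈⟨ +-congˡ (∑-comm (λ u v → [ lt u v ] N v u)) ⟩
    ∑∑ (λ u v → [ lt u v ] N u v) + ∑∑ (λ u v → [ lt v u ] N u v)
      ≈⟨ ∑∑-distrib-+ (λ u v → [ lt u v ] N u v) (λ u v → [ lt v u ] N u v) ⟨
    ∑∑ (λ u v → [ lt u v ] N u v + [ lt v u ] N u v)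
      ≈⟨ ∑∑-cong pair ⟩
    ∑∑ N ∎
    where
    pair : ∀ u v → [ lt u v ] N u v + [ lt v u ] N u v ≈ N u v
    pair u v with u ≟ v
    ... | yes ≡.refl = trans (+-cong ([]-0 (lt u u) (diag u)) ([]-0 (lt u u) (diag u))) (trans (+-identityˡ 0#) (sym (diag u)))
    ... | no u≢v rewrite lt-flip u≢v = []-split (lt u v) (N u v)

  pairWeight : ∀ {m} → (Fin m → Carrier) → (Fin m → Carrier) → Fin m → Fin m → Carrier
  pairWeight a b u v = a u * b v + a v * b u

  sumPairs≡∑∑ : ∀ G (T : VSet G) {f g : Fin (n G) → Fin (n G) → Carrier} → (∀ u v → f u v ≡ g u v) →
                sumPairs G T f ≡ ∑∑ (λ u v → [ lt u v ∧ T u ∧ T v ] g u v)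
  sumPairs≡∑∑ G T {f} f≡g =
    ≡.trans (sumF≡sum (λ u → sumF (F u)))
            (sum-cong-≗ {n G} (λ u → ≡.trans (sumF≡sum (F u)) (sum-cong-≗ {n G} (λ v → ≡.cong [ _ ]_ (f≡g u v)))))
    where
    F : Fin (n G) → Fin (n G) → Carrier
    F u v = [ lt u v ∧ T u ∧ T v ] f u v

  W≡∑∑ : ∀ G (T : VSet G) a b →
         W G T a b ≡ ∑∑ (λ u v → [ lt u v ∧ T u ∧ T v ] (distIn G T u v × pairWeight a b u v))
  W≡∑∑ G T a b = sumPairs≡∑∑ G T (λ u v → ·≡× (distIn G T u v) (pairWeight a b u v))

  module Decomposition (G : Graph) (conn : Connected G) (a b : Fin (n G) → Carrier) (c : Fin (n G)) where
    open TwinCollapse G c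

    a′ b′ : Fin (n G) → Carrier
    a′ = merged G c a
    b′ = merged G c b

    d′ : Fin (n G) → Fin (n G) → ℕ
    d′ = distIn G S

    -- A pair with exactly one endpoint in C is counted by the ordered pair listing that
    -- endpoint first (crossTerm), or, in G′, the endpoint c first (crossTerm′).
    outsideTerm twinTerm crossTerm crossTerm′ : Fin (n G) → Fin (n G) → Carrier
    outsideTerm u v = [ lt u v ∧ not (C u) ∧ not (C v) ] (d′ u v × pairWeight a b u v)
    twinTerm    u v = [ lt u v ∧ C u ∧ C v ] (2 × pairWeight a b u v)
    crossTerm   u v = [ not (C v) ] [ C u ] (d′ c v × pairWeight a b u v)
    crossTerm′  u v = [ not (C v) ] [ ⌊ u ≟ c ⌋ ] (d′ c v × pairWeight a′ b′ u v)

    W-summand-split : ∀ u v →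
      [ lt u v ∧ true ∧ true ] (distIn G (allV G) u v × pairWeight a b u v)
        ≈ outsideTerm u v + (twinTerm u v + ([ lt u v ] crossTerm u v + [ lt u v ] crossTerm v u))
    W-summand-split u v with lt u v in u<v | C u in u∈C | C v in v∈C
    ... | false | _     | _     = solve 0 (id ⊜ id ⊕ (id ⊕ (id ⊕ id))) refl
    ... | true  | false | false =
      trans (×-congˡ (distIn-∉C u∈C v∈C)) (solve 1 (λ x → x ⊜ x ⊕ (id ⊕ (id ⊕ id))) refl _)
    ... | true  | true  | true  =
      trans (×-congˡ (distIn-twins conn u∈C v∈C (lt⇒≢ u v u<v))) (solve 1 (λ x → x ⊜ id ⊕ (x ⊕ (id ⊕ id))) refl _)
    ... | true  | true  | false =
      trans (×-congˡ (distIn-∈C-∉C u∈C v∈C)) (solve 1 (λ x → x ⊜ id ⊕ (id ⊕ (x ⊕ id))) refl _)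
    ... | true  | false | true  =
      trans (×-cong (≡.trans (distIn-sym G (allV G) u v) (distIn-∈C-∉C v∈C u∈C)) (+-comm _ _))
            (solve 1 (λ x → x ⊜ id ⊕ (id ⊕ (id ⊕ x))) refl _)

    W′-summand-split : ∀ u v →
      [ lt u v ∧ S u ∧ S v ] (d′ u v × pairWeight a′ b′ u v)
        ≈ outsideTerm u v + ([ lt u v ] crossTerm′ u v + [ lt u v ] crossTerm′ v u)
    W′-summand-split u v with lt u v in u<v | C u in u∈C | C v in v∈C | u ≟ c | v ≟ c
    ... | false | _     | _     | _          | _          = solve 0 (id ⊜ id ⊕ (id ⊕ id)) refl
    ... | true  | false | _     | yes u≡c    | _          = ⊥-elim (∉C⇒≢c u∈C u≡c)
    ... | true  | _     | false | _          | yes v≡c    = ⊥-elim (∉C⇒≢c v∈C v≡c)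
    ... | true  | true  | true  | yes ≡.refl | yes ≡.refl = ⊥-elim (lt⇒≢ c c u<v ≡.refl)
    ... | true  | false | false | no _       | no _       = solve 1 (λ x → x ⊜ x ⊕ (id ⊕ id)) refl _
    ... | true  | true  | false | yes ≡.refl | no _       = solve 1 (λ x → x ⊜ id ⊕ (x ⊕ id)) refl _
    ... | true  | false | true  | no _       | yes ≡.refl =
      trans (×-cong (distIn-sym G S u c) (+-comm _ _)) (solve 1 (λ x → x ⊜ id ⊕ (id ⊕ x)) refl _)
    ... | true  | true  | true  | yes _      | no _       = solve 0 (id ⊜ id ⊕ (id ⊕ id)) refl
    ... | true  | true  | true  | no _       | _          = solve 0 (id ⊜ id ⊕ (id ⊕ id)) refl
    ... | true  | true  | false | no _       | no _       = solve 0 (id ⊜ id ⊕ (id ⊕ id)) refl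
    ... | true  | false | true  | no _       | no _       = solve 0 (id ⊜ id ⊕ (id ⊕ id)) refl

    merged-c : ∀ f → merged G c f c ≡ sumClass G c f
    merged-c f rewrite ⌊⌋-true (c ≟ c) ≡.refl = ≡.refl

    merged-∉C : ∀ f {v} → C v ≡ false → merged G c f v ≡ f v
    merged-∉C f {v} v∉C rewrite ⌊⌋-false (v ≟ c) (∉C⇒≢c v∉C) = ≡.refl

    classWeight : ∀ {v} → C v ≡ false → sum (λ u → [ C u ] pairWeight a b u v) ≈ pairWeight a′ b′ c v
    classWeight {v} v∉C = begin
      sum (λ u → [ C u ] (a u * b v + a v * b u))
        ≈⟨ sum-cong-≋ (λ u → trans ([]-+ (C u) _ _) (+-cong ([]-*ʳ (C u) (a u) (b v)) ([]-*ˡ (C u) (a v) (b u)))) ⟩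
      sum (λ u → [ C u ] a u * b v + a v * [ C u ] b u)
        ≈⟨ ∑-distrib-+ (λ u → [ C u ] a u * b v) (λ u → a v * [ C u ] b u) ⟩
      sum (λ u → [ C u ] a u * b v) + sum (λ u → a v * [ C u ] b u)
        ≈⟨ +-cong (*-distribʳ-sum (b v) (λ u → [ C u ] a u)) (*-distribˡ-sum (a v) (λ u → [ C u ] b u)) ⟨
      sum (λ u → [ C u ] a u) * b v + a v * sum (λ u → [ C u ] b u)
        ≡⟨ ≡.sym (≡.cong₂ (λ x y → x * b v + a v * y) (sumF≡sum (λ u → [ C u ] a u)) (sumF≡sum (λ u → [ C u ] b u))) ⟩
      sumClass G c a * b v + a v * sumClass G c b
        ≡⟨ ≡.sym (≡.cong₂ _+_ (≡.cong₂ _*_ (merged-c a) (merged-∉C b v∉C)) (≡.cong₂ _*_ (merged-∉C a v∉C) (merged-c b))) ⟩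
      pairWeight a′ b′ c v ∎

    crossTotal : Carrier
    crossTotal = sum (λ v → [ not (C v) ] (d′ c v × pairWeight a′ b′ c v))

    ∑∑-crossTerm : ∑∑ crossTerm ≈ crossTotal
    ∑∑-crossTerm = trans (∑-comm crossTerm) (sum-cong-≋ column)
      where
      column : ∀ v → sum (λ u → crossTerm u v) ≈ [ not (C v) ] (d′ c v × pairWeight a′ b′ c v)
      column v with C v in v∈C
      ... | true  = sum-replicate-zero (n G)
      ... | false = begin
        sum (λ u → [ C u ] (d′ c v × pairWeight a b u v)) ≈⟨ sum-cong-≋ (λ u → []-× (C u) (d′ c v) _) ⟩
        sum (λ u → d′ c v × [ C u ] pairWeight a b u v)  ≈⟨ ×-distrib-sum (d′ c v) (λ u → [ C u ] pairWeight a b u v) ⟨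
        d′ c v × sum (λ u → [ C u ] pairWeight a b u v)  ≈⟨ ×-congʳ (d′ c v) (classWeight v∈C) ⟩
        d′ c v × pairWeight a′ b′ c v                    ∎

    ∑∑-crossTerm′ : ∑∑ crossTerm′ ≈ crossTotal
    ∑∑-crossTerm′ = trans (∑-comm crossTerm′) (sum-cong-≋ column)
      where
      column : ∀ v → sum (λ u → crossTerm′ u v) ≈ [ not (C v) ] (d′ c v × pairWeight a′ b′ c v)
      column v = begin
        sum (λ u → [ not (C v) ] atC u)   ≈⟨ []-sum (not (C v)) atC ⟩
        [ not (C v) ] sum atC             ≈⟨ []-cong (not (C v)) (sum-pick atC c (λ u u≢c → []-false (⌊⌋-false (u ≟ c) u≢c))) ⟩
        [ not (C v) ] atC c               ≈⟨ []-cong (not (C v)) ([]-true (⌊⌋-true (c ≟ c) ≡.refl)) ⟩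
        [ not (C v) ] (d′ c v × pairWeight a′ b′ c v) ∎
        where
        atC : Fin (n G) → Carrier
        atC u = [ ⌊ u ≟ c ⌋ ] (d′ c v × pairWeight a′ b′ u v)

    crossTerm-diagonal : ∀ u → crossTerm u u ≈ 0#
    crossTerm-diagonal u with C u
    ... | true  = refl
    ... | false = refl

    crossTerm′-diagonal : ∀ u → crossTerm′ u u ≈ 0#
    crossTerm′-diagonal u with u ≟ c
    ... | yes ≡.refl = []-false (≡.cong not c∈C)
    ... | no _       = []-0 (not (C u)) refl

    W-decomposition : W G (allV G) a b ≈ ∑∑ outsideTerm + (∑∑ twinTerm + crossTotal)
    W-decomposition = begin
      W G (allV G) a b
        ≡⟨ W≡∑∑ G (allV G) a b ⟩
      ∑∑ (λ u v → [ lt u v ∧ true ∧ true ] (distIn G (allV G) u v × pairWeight a b u v))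
        ≈⟨ ∑∑-cong W-summand-split ⟩
      ∑∑ (λ u v → outsideTerm u v + (twinTerm u v + crossPair u v))
        ≈⟨ ∑∑-distrib-+ outsideTerm _ ⟩
      ∑∑ outsideTerm + ∑∑ (λ u v → twinTerm u v + crossPair u v)
        ≈⟨ +-congˡ (∑∑-distrib-+ twinTerm crossPair) ⟩
      ∑∑ outsideTerm + (∑∑ twinTerm + ∑∑ crossPair)
        ≈⟨ +-congˡ (+-congˡ (trans (∑∑-unordered crossTerm crossTerm-diagonal) ∑∑-crossTerm)) ⟩
      ∑∑ outsideTerm + (∑∑ twinTerm + crossTotal) ∎
      where
      crossPair : Fin (n G) → Fin (n G) → Carrier
      crossPair u v = [ lt u v ] crossTerm u v + [ lt u v ] crossTerm v u

    W′-decomposition : W G S a′ b′ ≈ ∑∑ outsideTerm + crossTotal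
    W′-decomposition = begin
      W G S a′ b′
        ≡⟨ W≡∑∑ G S a′ b′ ⟩
      ∑∑ (λ u v → [ lt u v ∧ S u ∧ S v ] (d′ u v × pairWeight a′ b′ u v))
        ≈⟨ ∑∑-cong W′-summand-split ⟩
      ∑∑ (λ u v → outsideTerm u v + crossPair u v)
        ≈⟨ ∑∑-distrib-+ outsideTerm crossPair ⟩
      ∑∑ outsideTerm + ∑∑ crossPair
        ≈⟨ +-congˡ (trans (∑∑-unordered crossTerm′ crossTerm′-diagonal) ∑∑-crossTerm′) ⟩
      ∑∑ outsideTerm + crossTotal ∎
      where
      crossPair : Fin (n G) → Fin (n G) → Carrier
      crossPair u v = [ lt u v ] crossTerm′ u v + [ lt u v ] crossTerm′ v u

    twinPairs≡∑∑ : sumPairs G C (λ u v → 2 · pairWeight a b u v) ≡ ∑∑ twinTerm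
    twinPairs≡∑∑ = sumPairs≡∑∑ G C (λ u v → ·≡× 2 (pairWeight a b u v))

mainTheorem8 : ∀ {ℓc ℓ : Level} (K : CommutativeSemiring ℓc ℓ) →
  let open CommutativeSemiring K
      open Weighted K
  in (G : Graph) → Connected G →
     (a b : Fin (n G) → Carrier) → (c : Fin (n G)) →
     W G (allV G) a b ≈
       (W G (G'set G c) (merged G c a) (merged G c b)
        + sumPairs G (inClass G c) (λ ci cj → 2 · ((a ci * b cj) + (a cj * b ci))))
mainTheorem8 K G conn a b c = begin
  W G (allV G) a b                            ≈⟨ W-decomposition ⟩
  ∑∑ outsideTerm + (∑∑ twinTerm + crossTotal) ≈⟨ +-congˡ (+-comm _ _) ⟩
  ∑∑ outsideTerm + (crossTotal + ∑∑ twinTerm) ≈⟨ +-assoc _ _ _ ⟨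
  (∑∑ outsideTerm + crossTotal) + ∑∑ twinTerm ≈⟨ +-cong W′-decomposition (reflexive twinPairs≡∑∑) ⟨
  W G S a′ b′ + sumPairs G C (λ u v → 2 · pairWeight a b u v) ∎
  where
  open CommutativeSemiring K
  open Weighted K
  open Sums K
  open TwinCollapse G c
  open Decomposition G conn a b c
  open import Relation.Binary.Reasoning.Setoid setoid
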